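{- Let $G=(V,E)$ be a digraph, $\bar s\in\mathbb{Z}_+$, $S=\{1,\dots,\bar s\}$, and $D$ a set of demands, and let $RSA(G,D,\bar s)$ be the polytope described in the context. Let $j\in V$ be such that $j\notin\{s(d),t(d)\}$ for every $d\in D$. Let $\sum_{d\in D}\sum_{e\in E}\sum_{s\in S}a_{des}u_{des}\le b$ be a valid inequality (resp., an optimality cut) for $RSA(G,D,\bar s)$ such that for every $d\in D$ and every $s\in S$ there exist $\alpha_{ds},\beta_{ds}\in\mathbb{R}$ with $a_{des}=\alpha_{ds}$ for every $e\in\delta^+(j)$ and $a_{des}=\beta_{ds}$ for every $e\in\delta^-(j)$. Then the inequality $$\sum_{s\in S}\sum_{d\in D}\Big(\sum_{e\in\delta^-(j)}\alpha_{ds}u_{des}+\sum_{e\in\delta^+(j)}\beta_{ds}u_{des}+\sum_{e\in E\setminus\delta(j)}a_{des}u_{des}\Big)\le b$$ is also valid (resp., an optimality cut) for $RSA(G,D,\bar s)$.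
   Context: Routing and spectrum allocation (RSA) setting: $G=(V,E)$ is a digraph, $\bar s\in\mathbb{Z}_+$ is the number of available slots, $S=\{1,\dots,\bar s\}$, and $D$ is a finite set of demands, each $d\in D$ being a triple $(s(d),t(d),v(d))$ with source $s(d)\in V$, target $t(d)\in V$ and volume $v(d)\in\mathbb{Z}_+$. For $j\in V$, $\delta^-(j)$ and $\delta^+(j)$ denote the sets of incoming and outgoing arcs of $j$, and $\delta(j)=\delta^-(j)\cup\delta^+(j)$. There is a binary variable $u_{des}$ for each $d\in D$, $e\in E$, $s\in S$ (meaning demand $d$ uses slot $s$ on arc $e$), together with fictitious variables $u_{de,\bar s+1}$ fixed to $0$. The DSL-BF formulation is: minimize $\sum_{d\in D}\sum_{e\in E}\sum_{s\in S}u_{des}/v(d)$ subject to (i) $\sum_{e\in\delta^-(j)}u_{des}-\sum_{e\in\delta^+(j)}u_{des}=0$ for all $d\in D$, $j\in V\setminus\{s(d),t(d)\}$, $s\in S$; (ii) $\sum_{e\in\delta^+(s(d))}\sum_{s\in S}u_{des}\ge v(d)$ for all $d\in D$; (iii) $\sum_{e\in\delta^-(s(d))}\sum_{s\in S}u_{des}=0$ for all $d\in D$; (iv) $\sum_{d\in D}u_{des}\le 1$ for all $e\in E$, $s\in S$; (v) $v(d)(u_{des}-u_{de,s+1})\le\sum_{s'=f}^{s}u_{des'}$ for all $d\in D$, $e\in E$, $s\in S$, where $f=\max\{1,s-v(d)+1\}$; (vi) $u_{des}\in\{0,1\}$ for all $d,e,s$. $RSA(G,D,\bar s)$ is the convex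 hull of the feasible solutions of (i)–(vi). A valid inequality is a linear inequality in $u$ satisfied by all points of $RSA(G,D,\bar s)$. An optimality cut is a linear inequality that is not valid but does not remove all optimal solutions of the DSL-BF formulation (i.e., some optimal solution satisfies it). -}

module Defs where

open import Level using (Level; _⊔_) renaming (suc to lsuc)
open import Data.Bool using (Bool; true; false; if_then_else_)
open import Data.Nat as ℕ using (ℕ; zero; suc; _<?_)
open import Data.Fin as Fin using (Fin; fromℕ<)
open import Data.Integer as ℤ using (ℤ)
open import Data.Rational as ℚ using (ℚ)
open import Data.Product using (Σ; _×_; _,_; ∃)
open import Relation.Nullary using (¬_; does)
open import Relation.Binary.Core using (Rel)
open import Relation.Binary.Structures using (IsTotalOrder)
open import Relation.Binary.PropositionalEquality using (_≡_; _≢_)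
open import Algebra.Bundles using (CommutativeRing)

-- Ordered commutative rings (the coefficient domain; ℝ is an instance)

record OrderedCommutativeRing (c ℓ₁ ℓ₂ : Level) : Set (lsuc (c ⊔ ℓ₁ ⊔ ℓ₂)) where
  field
    commutativeRing : CommutativeRing c ℓ₁
  open CommutativeRing commutativeRing public
  field
    _≤_          : Rel Carrier ℓ₂
    isTotalOrder : IsTotalOrder _≈_ _≤_
    +-mono-≤     : ∀ {x y} z → x ≤ y → (x + z) ≤ (y + z)
    *-nonneg     : ∀ {x y} → 0# ≤ x → 0# ≤ y → 0# ≤ (x * y)

ΣF : ∀ {n} → (Fin n → ℕ) → ℕ
ΣF {zero}  f = 0
ΣF {suc n} f = f Fin.zero ℕ.+ ΣF (λ i → f (Fin.suc i))

sumTo : (ℕ → ℕ) → ℕ → ℕ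
sumTo g zero    = 0
sumTo g (suc n) = sumTo g n ℕ.+ g n

-- Σ_{t = lo}^{hi} g t  (empty, i.e. 0, if hi < lo)
rangeSum : ℕ → ℕ → (ℕ → ℕ) → ℕ
rangeSum lo hi g = sumTo (λ i → g (lo ℕ.+ i)) (suc hi ℕ.∸ lo)

module _ {c ℓ} (R : CommutativeRing c ℓ) where
  open CommutativeRing R
  ΣR : ∀ {n} → (Fin n → Carrier) → Carrier
  ΣR {zero}  f = 0#
  ΣR {suc n} f = f Fin.zero + ΣR (λ i → f (Fin.suc i))

ΣQ : ∀ {n} → (Fin n → ℚ) → ℚ
ΣQ {zero}  f = ℚ.0ℚ
ΣQ {suc n} f = f Fin.zero ℚ.+ ΣQ (λ i → f (Fin.suc i))

⟦_⟧ : Bool → ℕ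
⟦ true ⟧  = 1
⟦ false ⟧ = 0

-- Digraph G = (V, E): V = Fin nV, E = Fin nE, arc e goes from tl e to hd e
record Digraph : Set where
  field
    nV nE : ℕ
    tl hd : Fin nE → Fin nV

-- An RSA instance: digraph, number of slots s̄ (slot i : Fin s̄ stands for
-- slot toℕ i + 1 of S = {1..s̄}), demands D = Fin nD with source, target, volume
record RSAInstance : Set where
  field
    G    : Digraph
  open Digraph G public
  field
    s̄    : ℕ
    nD   : ℕ
    src  : Fin nD → Fin nV
    tgt  : Fin nD → Fin nV
    vol  : Fin nD → ℕ

  Dm  = Fin nD
  Arc = Fin nE
  Slot = Fin s̄

  Assignment : Set
  Assignment = Dm → Arc → Slot → Bool

  inArc : Fin nV → Arc → Bool
  inArc j e = does (hd e Fin.≟ j)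
  outArc : Fin nV → Arc → Bool
  outArc j e = does (tl e Fin.≟ j)

  -- u_{des} as a natural number, with slots indexed 1..s̄ and
  -- u_{de,s} = 0 for s = 0 and s > s̄ (in particular the fictitious u_{de,s̄+1} = 0)
  uN : Assignment → Dm → Arc → ℕ → ℕ
  uN u d e zero    = 0
  uN u d e (suc i) with i <? s̄
  ... | Relation.Nullary.yes p = ⟦ u d e (fromℕ< p) ⟧
  ... | Relation.Nullary.no  _ = 0

  Σin Σout : Fin nV → (Arc → ℕ) → ℕ
  Σin  j x = ΣF (λ e → if inArc j e then x e else 0)
  Σout j x = ΣF (λ e → if outArc j e then x e else 0)

  -- feasibility for the DSL-BF constraints (i)-(v); (vi) is the Bool type
  record Feasible (u : Assignment) : Set where
    field
      flow     : ∀ d j s → j ≢ src d → j ≢ tgt d →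
                 Σin j (λ e → ⟦ u d e s ⟧) ≡ Σout j (λ e → ⟦ u d e s ⟧)
      volume   : ∀ d → vol d ℕ.≤ Σout (src d) (λ e → ΣF (λ s → ⟦ u d e s ⟧))
      noReturn : ∀ d → Σin (src d) (λ e → ΣF (λ s → ⟦ u d e s ⟧)) ≡ 0
      capacity : ∀ e s → ΣF (λ d → ⟦ u d e s ⟧) ℕ.≤ 1
      -- (v), for s ∈ {1..s̄}, with the (possibly negative) term
      -- v(d)(u_des - u_de,s+1) moved to the right-hand side
      contiguity : ∀ d e (s : ℕ) → 1 ℕ.≤ s → s ℕ.≤ s̄ →
                   vol d ℕ.* uN u d e s ℕ.≤
                   vol d ℕ.* uN u d e (suc s)
                     ℕ.+ rangeSum (1 ℕ.⊔ (suc s ℕ.∸ vol d)) s (uN u d e)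

  objective : (∀ d → ℕ.NonZero (vol d)) → Assignment → ℚ
  objective nz u = ΣQ (λ d → objD d (nz d))
    where
      objD : (d : Dm) → ℕ.NonZero (vol d) → ℚ
      objD d z = (ℤ.+ ΣF (λ e → ΣF (λ s → ⟦ u d e s ⟧))) ℚ./ vol d
        where instance _ = z

  Optimal : (∀ d → ℕ.NonZero (vol d)) → Assignment → Set
  Optimal nz u = Feasible u × (∀ u' → Feasible u' → objective nz u ℚ.≤ objective nz u')

-- An inequality is given by its left-hand side
-- as a function of u (a linear form) and its right-hand side b.

module _ {c ℓ₁ ℓ₂} (R : OrderedCommutativeRing c ℓ₁ ℓ₂) (I : RSAInstance) where
  open OrderedCommutativeRing R
  open RSAInstance I

  ⟦_⟧R : Bool → Carrier
  ⟦ true ⟧R  = 1#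
  ⟦ false ⟧R = 0#

  linForm : (Dm → Arc → Slot → Carrier) → Assignment → Carrier
  linForm a u = ΣR commutativeRing (λ d → ΣR commutativeRing (λ e →
                  ΣR commutativeRing (λ s → a d e s * ⟦ u d e s ⟧R)))

  -- validity for RSA(G,D,s̄) = conv of feasible points: satisfied by every
  -- feasible (integer) solution
  Valid : (Assignment → Carrier) → Carrier → Set _
  Valid lhs b = ∀ u → Feasible u → lhs u ≤ b

  OptimalityCut : (∀ d → ℕ.NonZero (vol d)) → (Assignment → Carrier) → Carrier → Set _
  OptimalityCut nz lhs b =
    ¬ Valid lhs b × ∃ λ u → Optimal nz u × (lhs u ≤ b)

  swappedForm : Fin nV → (Dm → Arc → Slot → Carrier) →
                (Dm → Slot → Carrier) → (Dm → Slot → Carrier) → Assignment → Carrier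
  swappedForm j a α β u =
    ΣR commutativeRing (λ s → ΣR commutativeRing (λ d →
        ΣR commutativeRing (λ e → if inArc j e then α d s * ⟦ u d e s ⟧R else 0#)
      + ΣR commutativeRing (λ e → if outArc j e then β d s * ⟦ u d e s ⟧R else 0#)
      + ΣR commutativeRing (λ e → if inArc j e then 0#
                                   else if outArc j e then 0#
                                   else a d e s * ⟦ u d e s ⟧R)))

{-# OPTIONS --safe #-}
module Submission where

-- At a vertex j that is neither a source nor a target, every feasible solution
-- conserves flow slot by slot: Σ_{δ⁻(j)} u_des = Σ_{δ⁺(j)} u_des.  Since the
-- coefficients are constant (α on δ⁺(j), β on δ⁻(j)) for fixed d and s, the
-- terms α·Σ_{δ⁺(j)} u and β·Σ_{δ⁻(j)} u may be replaced by α·Σ_{δ⁻(j)} u and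
-- β·Σ_{δ⁺(j)} u.  As there are no loops, δ⁺(j), δ⁻(j) and E ∖ δ(j) partition E,
-- so both left-hand sides take the same value at every feasible point, and
-- validity and optimality cuts depend on nothing else.

open import Defs
open import Data.Fin using (Fin)
open import Data.Nat using (NonZero)
open import Data.Product using (_×_)
open import Relation.Binary.PropositionalEquality using (_≡_; _≢_)

open import Algebra.Bundles using (CommutativeRing)
open import Data.Bool using (Bool; true; false; if_then_else_; T)
open import Data.Empty using (⊥; ⊥-elim)
open import Data.Unit using (tt)
open import Data.Fin as Fin using (zero; suc)
open import Data.Nat as ℕ using (ℕ)
open import Data.Product using (_,_; proj₁; proj₂)
open import Relation.Binary.Structures using (IsTotalOrder)
open import Relation.Nullary using (Dec; does; yes; no)
import Relation.Binary.PropositionalEquality as ≡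
import Relation.Binary.Reasoning.Setoid as SetoidReasoning

T-does : ∀ {p} {P : Set p} (P? : Dec P) → T (does P?) → P
T-does (yes p) _ = p
T-does (no _)  ()

module RingSums {c ℓ} (R : CommutativeRing c ℓ) where
  open CommutativeRing R hiding (zero)
  open import Algebra.Properties.Semiring.Sum semiring
    using (sum; ∑-distrib-+; ∑-comm; *-distribˡ-sum)
  open import Algebra.Properties.Monoid.Mult +-monoid using (×-homo-+) renaming (_×_ to _×ᵣ_)
  open SetoidReasoning setoid

  Σ : ∀ {n} → (Fin n → Carrier) → Carrier
  Σ = ΣR R

  Σ≡sum : ∀ {n} (f : Fin n → Carrier) → Σ f ≡ sum f
  Σ≡sum {ℕ.zero}  f = ≡.refl
  Σ≡sum {ℕ.suc n} f = ≡.cong (f zero +_) (Σ≡sum (λ i → f (suc i)))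

  Σ-cong : ∀ {n} {f g : Fin n → Carrier} → (∀ i → f i ≈ g i) → Σ f ≈ Σ g
  Σ-cong {ℕ.zero}  f≈g = refl
  Σ-cong {ℕ.suc n} f≈g = +-cong (f≈g zero) (Σ-cong (λ i → f≈g (suc i)))

  Σ-distrib-+ : ∀ {n} (f g : Fin n → Carrier) → Σ (λ i → f i + g i) ≈ Σ f + Σ g
  Σ-distrib-+ f g = begin
    Σ (λ i → f i + g i)   ≡⟨ Σ≡sum (λ i → f i + g i) ⟩
    sum (λ i → f i + g i) ≈⟨ ∑-distrib-+ f g ⟩
    sum f + sum g         ≡⟨ ≡.cong₂ _+_ (≡.sym (Σ≡sum f)) (≡.sym (Σ≡sum g)) ⟩
    Σ f + Σ g             ∎

  *-distribˡ-Σ : ∀ {n} k (f : Fin n → Carrier) → k * Σ f ≈ Σ (λ i → k * f i)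
  *-distribˡ-Σ k f = begin
    k * Σ f             ≡⟨ ≡.cong (k *_) (Σ≡sum f) ⟩
    k * sum f           ≈⟨ *-distribˡ-sum k f ⟩
    sum (λ i → k * f i) ≡⟨ ≡.sym (Σ≡sum (λ i → k * f i)) ⟩
    Σ (λ i → k * f i)   ∎

  Σ-comm : ∀ {m n} (f : Fin m → Fin n → Carrier) →
           Σ (λ i → Σ (λ j → f i j)) ≈ Σ (λ j → Σ (λ i → f i j))
  Σ-comm f = begin
    Σ (λ i → Σ (λ j → f i j))     ≈⟨ Σ-cong (λ i → reflexive (Σ≡sum (f i))) ⟩
    Σ (λ i → sum (λ j → f i j))   ≡⟨ Σ≡sum (λ i → sum (f i)) ⟩
    sum (λ i → sum (λ j → f i j)) ≈⟨ ∑-comm f ⟩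
    sum (λ j → sum (λ i → f i j)) ≡⟨ ≡.sym (Σ≡sum (λ j → sum (λ i → f i j))) ⟩
    Σ (λ j → sum (λ i → f i j))   ≈⟨ Σ-cong (λ j → reflexive (≡.sym (Σ≡sum (λ i → f i j)))) ⟩
    Σ (λ j → Σ (λ i → f i j))     ∎

  ΣF-×ᵣ : ∀ {n} (f : Fin n → ℕ) x → ΣF f ×ᵣ x ≈ Σ (λ i → f i ×ᵣ x)
  ΣF-×ᵣ {ℕ.zero}  f x = refl
  ΣF-×ᵣ {ℕ.suc n} f x =
    trans (×-homo-+ x (f zero) (ΣF (λ i → f (suc i))))
          (+-congˡ (ΣF-×ᵣ (λ i → f (suc i)) x))

  Σ-restrict : ∀ {n} → (Fin n → Bool) → (Fin n → Carrier) → Carrier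
  Σ-restrict p f = Σ (λ i → if p i then f i else 0#)

  *-distribˡ-Σ-restrict : ∀ {n} (p : Fin n → Bool) k (f : Fin n → Carrier) →
                          k * Σ-restrict p f ≈ Σ-restrict p (λ i → k * f i)
  *-distribˡ-Σ-restrict p k f =
    trans (*-distribˡ-Σ k (λ i → if p i then f i else 0#)) (Σ-cong (λ i → *-if (p i)))
    where
    *-if : ∀ {x} b → k * (if b then x else 0#) ≈ (if b then k * x else 0#)
    *-if true  = refl
    *-if false = zeroʳ k

  Σ-restrict-cong : ∀ {n} (p : Fin n → Bool) {f g : Fin n → Carrier} →
                    (∀ i → T (p i) → f i ≈ g i) → Σ-restrict p f ≈ Σ-restrict p g
  Σ-restrict-cong p {f} {g} f≈g = Σ-cong (λ i → if-cong (p i) (f≈g i))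
    where
    if-cong : ∀ {x y} b → (T b → x ≈ y) → (if b then x else 0#) ≈ (if b then y else 0#)
    if-cong true  x≈y = x≈y tt
    if-cong false _   = refl

  Σ-restrict-transfer : ∀ {n} (p q : Fin n → Bool) (x a : Fin n → Carrier) k →
    Σ-restrict p x ≈ Σ-restrict q x → (∀ i → T (q i) → k ≈ a i) →
    Σ-restrict p (λ i → k * x i) ≈ Σ-restrict q (λ i → a i * x i)
  Σ-restrict-transfer p q x a k p≈q k≈a = begin
    Σ-restrict p (λ i → k * x i)   ≈⟨ sym (*-distribˡ-Σ-restrict p k x) ⟩
    k * Σ-restrict p x             ≈⟨ *-congˡ p≈q ⟩
    k * Σ-restrict q x             ≈⟨ *-distribˡ-Σ-restrict q k x ⟩
    Σ-restrict q (λ i → k * x i)   ≈⟨ Σ-restrict-cong q (λ i qᵢ → *-congʳ (k≈a i qᵢ)) ⟩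
    Σ-restrict q (λ i → a i * x i) ∎

  Σ-restrict-partition : ∀ {n} (p q : Fin n → Bool) (f : Fin n → Carrier) →
    (∀ i → T (p i) → T (q i) → ⊥) →
    Σ-restrict q f + Σ-restrict p f
      + Σ (λ i → if p i then 0# else if q i then 0# else f i) ≈ Σ f
  Σ-restrict-partition p q f disjoint = begin
    Σ-restrict q f + Σ-restrict p f + Σ rest
      ≈⟨ +-congʳ (sym (Σ-distrib-+ (restrict q) (restrict p))) ⟩
    Σ (λ i → restrict q i + restrict p i) + Σ rest
      ≈⟨ sym (Σ-distrib-+ (λ i → restrict q i + restrict p i) rest) ⟩
    Σ (λ i → restrict q i + restrict p i + rest i)
      ≈⟨ Σ-cong (λ i → pointwise (p i) (q i) (disjoint i)) ⟩
    Σ f ∎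
    where
    restrict : (Fin _ → Bool) → Fin _ → Carrier
    restrict r i = if r i then f i else 0#
    rest : Fin _ → Carrier
    rest i = if p i then 0# else if q i then 0# else f i
    pointwise : ∀ {x} b b′ → (T b → T b′ → ⊥) →
      (if b′ then x else 0#) + (if b then x else 0#)
        + (if b then 0# else if b′ then 0# else x) ≈ x
    pointwise true  true  both = ⊥-elim (both tt tt)
    pointwise true  false _    = trans (+-identityʳ _) (+-identityˡ _)
    pointwise false true  _    = trans (+-identityʳ _) (+-identityʳ _)
    pointwise false false _    = trans (+-congʳ (+-identityˡ _)) (+-identityˡ _)

module _ {c ℓ₁ ℓ₂} (R : OrderedCommutativeRing c ℓ₁ ℓ₂) (I : RSAInstance) where
  open OrderedCommutativeRing R
  open RSAInstance I
  open RingSums commutativeRing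
  open import Algebra.Properties.Monoid.Mult +-monoid using () renaming (_×_ to _×ᵣ_)
  open SetoidReasoning setoid

  ⟦⟧×1≈⟦⟧R : ∀ b → ⟦ b ⟧ ×ᵣ 1# ≈ ⟦_⟧R R I b
  ⟦⟧×1≈⟦⟧R true  = +-identityʳ 1#
  ⟦⟧×1≈⟦⟧R false = refl

  ΣF-restrict×1 : ∀ {n} (p w : Fin n → Bool) →
    ΣF (λ i → if p i then ⟦ w i ⟧ else 0) ×ᵣ 1# ≈ Σ-restrict p (λ i → ⟦_⟧R R I (w i))
  ΣF-restrict×1 p w =
    trans (ΣF-×ᵣ (λ i → if p i then ⟦ w i ⟧ else 0) 1#) (Σ-cong (λ i → if-×1 (p i)))
    where
    if-×1 : ∀ {b′} b → (if b then ⟦ b′ ⟧ else 0) ×ᵣ 1# ≈ (if b then ⟦_⟧R R I b′ else 0#)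
    if-×1 {b′} true  = ⟦⟧×1≈⟦⟧R b′
    if-×1 false = refl

  flow-conservation : ∀ {u} → Feasible u → ∀ j → (∀ d → j ≢ src d × j ≢ tgt d) →
    ∀ d s → Σ-restrict (inArc j) (λ e → ⟦_⟧R R I (u d e s))
          ≈ Σ-restrict (outArc j) (λ e → ⟦_⟧R R I (u d e s))
  flow-conservation {u} F j transit d s = begin
    Σ-restrict (inArc j) x       ≈⟨ sym (ΣF-restrict×1 (inArc j) (λ e → u d e s)) ⟩
    Σin j (λ e → ⟦ u d e s ⟧) ×ᵣ 1#
      ≡⟨ ≡.cong (_×ᵣ 1#) (Feasible.flow F d j s (proj₁ (transit d)) (proj₂ (transit d))) ⟩
    Σout j (λ e → ⟦ u d e s ⟧) ×ᵣ 1# ≈⟨ ΣF-restrict×1 (outArc j) (λ e → u d e s) ⟩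
    Σ-restrict (outArc j) x      ∎
    where
    x : Arc → Carrier
    x e = ⟦_⟧R R I (u d e s)

  swappedForm≈linForm : (∀ e → tl e ≢ hd e) →
    ∀ j → (∀ d → j ≢ src d × j ≢ tgt d) →
    ∀ a α β → (∀ d e s → tl e ≡ j → a d e s ≈ α d s) → (∀ d e s → hd e ≡ j → a d e s ≈ β d s) →
    ∀ {u} → Feasible u → swappedForm R I j a α β u ≈ linForm R I a u
  swappedForm≈linForm loopless j transit a α β a≈α a≈β {u} F = begin
    swappedForm R I j a α β u         ≈⟨ Σ-cong (λ s → Σ-cong (λ d → slot d s)) ⟩
    Σ (λ s → Σ (λ d → Σ (λ e → ax d e s))) ≈⟨ Σ-comm (λ s d → Σ (λ e → ax d e s)) ⟩
    Σ (λ d → Σ (λ s → Σ (λ e → ax d e s))) ≈⟨ Σ-cong (λ d → Σ-comm (λ s e → ax d e s)) ⟩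
    linForm R I a u                   ∎
    where
    x : Dm → Arc → Slot → Carrier
    x d e s = ⟦_⟧R R I (u d e s)
    ax : Dm → Arc → Slot → Carrier
    ax d e s = a d e s * x d e s
    out-tl : ∀ {e} → T (outArc j e) → tl e ≡ j
    out-tl {e} = T-does (tl e Fin.≟ j)
    in-hd : ∀ {e} → T (inArc j e) → hd e ≡ j
    in-hd {e} = T-does (hd e Fin.≟ j)
    not-both : ∀ e → T (inArc j e) → T (outArc j e) → ⊥
    not-both e into out = loopless e (≡.trans (out-tl out) (≡.sym (in-hd into)))
    slot : ∀ d s →
        Σ-restrict (inArc j) (λ e → α d s * x d e s)
      + Σ-restrict (outArc j) (λ e → β d s * x d e s)
      + Σ (λ e → if inArc j e then 0# else if outArc j e then 0# else ax d e s)
      ≈ Σ (λ e → ax d e s)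
    slot d s = trans
      (+-congʳ (+-cong
        (Σ-restrict-transfer (inArc j) (outArc j) (λ e → x d e s) (λ e → a d e s) (α d s)
           (flow-conservation F j transit d s) (λ e out → sym (a≈α d e s (out-tl out))))
        (Σ-restrict-transfer (outArc j) (inArc j) (λ e → x d e s) (λ e → a d e s) (β d s)
           (sym (flow-conservation F j transit d s)) (λ e into → sym (a≈β d e s (in-hd into))))))
      (Σ-restrict-partition (inArc j) (outArc j) (λ e → ax d e s) not-both)

  Valid-resp : ∀ {f g : Assignment → Carrier} {b} → (∀ {u} → Feasible u → f u ≈ g u) →
               Valid R I f b → Valid R I g b
  Valid-resp f≈g valid u F = IsTotalOrder.≲-respˡ-≈ isTotalOrder (f≈g F) (valid u F)

  OptimalityCut-resp : ∀ {f g : Assignment → Carrier} {b} nz → (∀ {u} → Feasible u → f u ≈ g u) →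
                       OptimalityCut R I nz f b → OptimalityCut R I nz g b
  OptimalityCut-resp nz f≈g (invalid , u , optimal , f[u]≤b) =
      (λ valid → invalid (Valid-resp (λ F → sym (f≈g F)) valid))
    , u , optimal , IsTotalOrder.≲-respˡ-≈ isTotalOrder (f≈g (proj₁ optimal)) f[u]≤b

theorem2 : ∀ {c ℓ₁ ℓ₂} (R : OrderedCommutativeRing c ℓ₁ ℓ₂) (I : RSAInstance) →
    let open OrderedCommutativeRing R
        open RSAInstance I
    in (∀ e → tl e ≢ hd e) →
       (j : Fin nV) → (∀ d → j ≢ src d × j ≢ tgt d) →
       (a : Dm → Arc → Slot → Carrier) (b : Carrier) (α β : Dm → Slot → Carrier) →
       (∀ d e s → tl e ≡ j → a d e s ≈ α d s) →
       (∀ d e s → hd e ≡ j → a d e s ≈ β d s) →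
       (Valid R I (linForm R I a) b → Valid R I (swappedForm R I j a α β) b)
       × ((nz : ∀ d → NonZero (vol d)) →
          OptimalityCut R I nz (linForm R I a) b →
          OptimalityCut R I nz (swappedForm R I j a α β) b)
theorem2 R I loopless j transit a b α β a≈α a≈β =
  Valid-resp R I agree , λ nz → OptimalityCut-resp R I nz agree
  where
  open OrderedCommutativeRing R using (_≈_; sym)
  open RSAInstance I using (Feasible)
  agree : ∀ {u} → Feasible u → linForm R I a u ≈ swappedForm R I j a α β u
  agree F = sym (swappedForm≈linForm R I loopless j transit a α β a≈α a≈β F)
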